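{- Let $G=\{g_1,\dots,g_m\}$ be a set of nonzero Boolean functions $\{0,1\}^n\to\{0,1\}$, let $g=\sum_{i=1}^m g_i$, and let $f$ be a Boolean function with $f\le g$. Then the equation $f(X)=1$ has a solution $X\in\{0,1\}^n$ if and only if there exists an index $i\in\{1,\dots,m\}$ such that, for every cofactor $\alpha_i\in\Xi(f,g_i)$, the system $\alpha_i(X)=1,\ g_i(X)=1$ has a solution $X\in\{0,1\}^n$.
   Context: Boolean functions are maps $\{0,1\}^n \to \{0,1\}$; $+$ and $\sum$ denote OR, $\le$ is the pointwise order. For $g$, $\mathrm{supp}(g)=\{x : g(x)=1\}$. For $g\neq 0$, the set of cofactors $\Xi(f,g)$ is the set of all Boolean functions (in the same $n$ variables) whose restriction to $\mathrm{supp}(g)$ coincides with that of $f$. An equation or system is called consistent if it has a solution in $\{0,1\}^n$. -}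

module Defs where

open import Data.Bool using (Bool; true; false; _∨_; _∧_)
open import Data.Nat using (ℕ; zero; suc)
open import Data.Fin using (Fin)
open import Data.Vec using (Vec)
open import Data.Product using (Σ; ∃; _×_)
open import Relation.Binary.PropositionalEquality using (_≡_)

BoolFn : ℕ → Set
BoolFn n = Vec Bool n → Bool

Nonzero : ∀ {n} → BoolFn n → Set
Nonzero {n} g = ∃ λ (x : Vec Bool n) → g x ≡ true

_≤ᶠ_ : ∀ {n} → BoolFn n → BoolFn n → Set
f ≤ᶠ g = ∀ x → f x ≡ true → g x ≡ true

bigOr : ∀ {n} (m : ℕ) → (Fin m → BoolFn n) → BoolFn n
bigOr zero    gs x = false
bigOr (suc m) gs x = gs Fin.zero x ∨ bigOr m (λ i → gs (Fin.suc i)) x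

IsCofactor : ∀ {n} → BoolFn n → BoolFn n → BoolFn n → Set
IsCofactor f g α = ∀ x → g x ≡ true → α x ≡ f x

Consistent : ∀ {n} → BoolFn n → Set
Consistent {n} f = ∃ λ (x : Vec Bool n) → f x ≡ true

SystemConsistent : ∀ {n} → BoolFn n → BoolFn n → Set
SystemConsistent {n} α g = ∃ λ (x : Vec Bool n) → (α x ≡ true) × (g x ≡ true)

-- A solution x of f(X) = 1 lies in supp(g), hence in some supp(gᵢ), where every
-- cofactor in Ξ(f,gᵢ) agrees with f; so x solves each system αᵢ(X) = 1, gᵢ(X) = 1.
-- Conversely f itself belongs to every Ξ(f,gᵢ), and a solution of f(X) = 1, gᵢ(X) = 1
-- solves f(X) = 1. Neither direction uses that the gᵢ are nonzero.
module Submission where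

open import Defs
open import Data.Nat using (ℕ; zero; suc)
open import Data.Fin using (Fin)
open import Data.Bool using (true; false)
open import Data.Product using (∃; _,_; map)
open import Function using (id)
open import Function.Bundles using (_⇔_; mk⇔)
open import Relation.Binary.PropositionalEquality using (_≡_; refl; trans)

bigOr-true⇒∃ : ∀ {n} m (gs : Fin m → BoolFn n) x →
               bigOr m gs x ≡ true → ∃ λ i → gs i x ≡ true
bigOr-true⇒∃ zero    gs x ()
bigOr-true⇒∃ (suc m) gs x or≡true with gs Fin.zero x in g₀x
... | true  = Fin.zero , g₀x
... | false = map Fin.suc id (bigOr-true⇒∃ m (λ i → gs (Fin.suc i)) x or≡true)

isCofactor-refl : ∀ {n} (f g : BoolFn n) → IsCofactor f g f
isCofactor-refl f g x _ = refl

cofactor-solves : ∀ {n} {f g α : BoolFn n} → IsCofactor f g α →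
                  ∀ x → f x ≡ true → g x ≡ true → SystemConsistent α g
cofactor-solves α∈Ξ x fx gx = x , trans (α∈Ξ x gx) fx , gx

mainTheorem6 : (n m : ℕ) (gs : Fin m → BoolFn n) (f : BoolFn n) →
    (∀ i → Nonzero (gs i)) →
    f ≤ᶠ bigOr m gs →
    Consistent f ⇔ (∃ λ (i : Fin m) → (α : BoolFn n) → IsCofactor f (gs i) α → SystemConsistent α (gs i))
mainTheorem6 n m gs f _ f≤g = mk⇔ to from
  where
  to : Consistent f → ∃ λ i → (α : BoolFn n) → IsCofactor f (gs i) α → SystemConsistent α (gs i)
  to (x , fx) with bigOr-true⇒∃ m gs x (f≤g x fx)
  ... | i , gᵢx = i , λ α α∈Ξ → cofactor-solves α∈Ξ x fx gᵢx

  from : (∃ λ i → (α : BoolFn n) → IsCofactor f (gs i) α → SystemConsistent α (gs i)) → Consistent f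
  from (i , allSolvable) with allSolvable f (isCofactor-refl f (gs i))
  ... | x , fx , _ = x , fx
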